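{- Let $k' > k$ be natural numbers and let $\mathcal D$ be a class of $k$-ary upwards-closed (not necessarily first-order) dependency notions. Then the $k'$-ary totality atom $\mathrm{All}_{k'}$ is not definable in $\mathbf{FO}(=\!(\cdot), \mathcal D, \sqcup)$.
   Context: Team semantics (lax version). Let $\mathfrak M$ be a structure with domain $M$. A team $X$ is a set of assignments $s: V \to M$ on a common domain $V$; $X(\bar v) = \{s(\bar v): s\in X\}$. First-order parts of formulas are in negation normal form. Satisfaction: literal $\alpha$: every $s\in X$ satisfies $\alpha$ (Tarski); $\psi\vee\theta$: $X = Y\cup Z$ with $\mathfrak M\models_Y\psi$, $\mathfrak M\models_Z\theta$; $\wedge$: both; $\exists v\psi$: some $F: X\to\mathcal P(M)\setminus\{\emptyset\}$ with $\mathfrak M\models_{X[F/v]}\psi$, $X[F/v]=\{s[m/v]: s\in X, m\in F(s)\}$; $\forall v\psi$: $\mathfrak M\models_{X[M/v]}\psi$, $X[M/v]=\{s[m/v]: s\in X,m\in M\}$; $\varphi\sqcup\psi$: $\mathfrak M\models_X\varphi$ or $\mathfrak M\models_X\psi$. A $k$-ary dependency notion $\mathbf D$ is a class, closed under isomorphism, of structures $(M,R)$ with $R$ a $k$-ary relation; for a $k$-tuple $\bar v$ of variables, $\mathfrak M\models_X \mathbf D\bar v$ iff $(M, X(\bar v))\in\mathbf D$. $\mathbf D$ is upwards-closed if $(M,R)\in\mathbf D$ and $R\subseteq S$ imply $(M,S)\in\mathbf D$. Constancy atoms: $\mathfrak M\models_X =\!(\bar v)$ iff $s(\bar v)=s'(\bar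 v)$ for all $s,s'\in X$; $=\!(\cdot)$ denotes all constancy atoms of all arities. Totality atom: $\mathfrak M\models_X \mathrm{All}_{k}(\bar v)$ (with $|\bar v| = k$) iff $X(\bar v)=M^{k}$. $\mathbf{FO}(\ldots)$ is first-order logic extended with the listed atoms/connectives. A $k$-ary dependency $\mathbf D$ is definable in a logic $L$ if there is a formula $\theta(\bar v)$ of $L$ over the empty vocabulary, $\bar v$ a tuple of $k$ distinct variables, such that for all structures $\mathfrak M$ and teams $X$ whose domain contains $\bar v$, $\mathfrak M\models_X\mathbf D\bar v$ iff $\mathfrak M\models_X\theta(\bar v)$. -}

module Defs where

open import Data.Nat using (ℕ; _≡ᵇ_)
open import Data.Fin using (Fin)
open import Data.Bool using (if_then_else_)
open import Data.List using (List; map)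
open import Data.List.Membership.Propositional using (_∈_)
open import Data.Product using (Σ; ∃; ∃-syntax; _×_; _,_)
open import Data.Sum using (_⊎_)
open import Function using (_∘_; Injective)
open import Function.Bundles using (_⇔_; Inverse)
open import Relation.Binary.PropositionalEquality using (_≡_; _≢_)
open import Relation.Nullary using (¬_)
import Level
open import Relation.Binary.PropositionalEquality.Properties using () renaming (setoid to ≡-setoid)

Assignment : Set → Set
Assignment M = ℕ → M

Team : Set → Set₁
Team M = Assignment M → Set

_[_/_] : {M : Set} → Assignment M → M → ℕ → Assignment M
(s [ m / v ]) u = if u ≡ᵇ v then m else s u

_≐_ : {M : Set} → Assignment M → Assignment M → Set
s ≐ t = ∀ u → s u ≡ t u

_⟦_⟧ : {M : Set} {k : ℕ} → Team M → (Fin k → ℕ) → (Fin k → M) → Set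
(X ⟦ vs ⟧) t = ∃[ s ] (X s × (∀ i → s (vs i) ≡ t i))

-- k-ary dependency notions: classes of structures (M , R), R ⊆ M^k,
-- closed under isomorphism.

RawDep : ℕ → Set₁
RawDep k = (M : Set) → ((Fin k → M) → Set) → Set

record DepNotion (k : ℕ) : Set₁ where
  field
    D : RawDep k
    iso-closed : {M N : Set} (f : Inverse (≡-setoid M) (≡-setoid N))
                 (R : (Fin k → M) → Set) (S : (Fin k → N) → Set) →
                 (∀ t → R t ⇔ S (Inverse.to f ∘ t)) →
                 D M R → D N S

open DepNotion public

UpwardsClosed : {k : ℕ} → DepNotion k → Set₁
UpwardsClosed 𝐃 = ∀ (M : Set) (R S : _ → Set) →
  D 𝐃 M R → (∀ t → R t → S t) → D 𝐃 M S

-- Formulas of FO(=(·), 𝒟, ⊔) over the empty vocabulary, negation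
-- normal form.  𝒟 is a class of k-ary dependency notions, given by a
-- membership predicate.

data Formula {k : ℕ} (𝒟 : DepNotion k → Set) : Set₁ where
  eq    : ℕ → ℕ → Formula 𝒟
  neq   : ℕ → ℕ → Formula 𝒟
  const : List ℕ → Formula 𝒟
  dep   : (𝐃 : DepNotion k) → 𝒟 𝐃 → (Fin k → ℕ) → Formula 𝒟
  _∨ᶠ_  : Formula 𝒟 → Formula 𝒟 → Formula 𝒟
  _∧ᶠ_  : Formula 𝒟 → Formula 𝒟 → Formula 𝒟
  ∃ᶠ    : ℕ → Formula 𝒟 → Formula 𝒟
  ∀ᶠ    : ℕ → Formula 𝒟 → Formula 𝒟
  _⊔ᶠ_  : Formula 𝒟 → Formula 𝒟 → Formula 𝒟

FreeIn : {k : ℕ} {𝒟 : DepNotion k → Set} → ℕ → Formula 𝒟 → Set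
FreeIn u (eq x y) = u ≡ x ⊎ u ≡ y
FreeIn u (neq x y) = u ≡ x ⊎ u ≡ y
FreeIn u (const vs) = u ∈ vs
FreeIn u (dep _ _ vs) = ∃[ i ] vs i ≡ u
FreeIn u (φ ∨ᶠ ψ) = FreeIn u φ ⊎ FreeIn u ψ
FreeIn u (φ ∧ᶠ ψ) = FreeIn u φ ⊎ FreeIn u ψ
FreeIn u (∃ᶠ v φ) = u ≢ v × FreeIn u φ
FreeIn u (∀ᶠ v φ) = u ≢ v × FreeIn u φ
FreeIn u (φ ⊔ᶠ ψ) = FreeIn u φ ⊎ FreeIn u ψ

supplement : {M : Set} → Team M → (Assignment M → M → Set) → ℕ → Team M
supplement X F v t = ∃[ s ] ∃[ m ] (X s × F s m × t ≐ (s [ m / v ]))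

duplicate : {M : Set} → Team M → ℕ → Team M
duplicate X v t = ∃[ s ] ∃[ m ] (X s × t ≐ (s [ m / v ]))

-- lax team semantics
Sat : {k : ℕ} {𝒟 : DepNotion k → Set} (M : Set) → Team M → Formula 𝒟 → Set₁
Sat M X (eq x y) = Level.Lift _ (∀ s → X s → s x ≡ s y)
Sat M X (neq x y) = Level.Lift _ (∀ s → X s → ¬ s x ≡ s y)
Sat M X (const vs) = Level.Lift _ (∀ s s' → X s → X s' → map s vs ≡ map s' vs)
Sat M X (dep 𝐃 _ vs) = Level.Lift _ (D 𝐃 M (X ⟦ vs ⟧))
Sat M X (φ ∨ᶠ ψ) = Σ (Team M) λ Y → Σ (Team M) λ Z →
  (∀ s → X s ⇔ (Y s ⊎ Z s)) × Sat M Y φ × Sat M Z ψ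
Sat M X (φ ∧ᶠ ψ) = Sat M X φ × Sat M X ψ
Sat M X (∃ᶠ v φ) = Σ (Assignment M → M → Set) λ F →
  (∀ s → X s → ∃[ m ] F s m) × Sat M (supplement X F v) φ
Sat M X (∀ᶠ v φ) = Sat M (duplicate X v) φ
Sat M X (φ ⊔ᶠ ψ) = Sat M X φ ⊎ Sat M X ψ

-- Definability of an n-ary dependency (given by its raw class of
-- structures) in FO(=(·), 𝒟, ⊔): a formula θ(v̄), v̄ a tuple of n
-- distinct variables containing all free variables of θ, such that for
-- every (nonempty) structure M and team X: M ⊨_X 𝐄 v̄ iff M ⊨_X θ.

Definable : {k : ℕ} (𝒟 : DepNotion k → Set) {n : ℕ} → RawDep n → Set₁
Definable 𝒟 {n} 𝐄 =
  Σ (Fin n → ℕ) λ vs → Injective _≡_ _≡_ vs ×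
  Σ (Formula 𝒟) λ θ → (∀ u → FreeIn u θ → ∃[ i ] vs i ≡ u) ×
  (∀ (M : Set) → M → ∀ (X : Team M) →
     (𝐄 M (X ⟦ vs ⟧) → Sat M X θ) × (Sat M X θ → 𝐄 M (X ⟦ vs ⟧)))

All : (n : ℕ) → RawDep n
All n M R = ∀ (t : Fin n → M) → R t

-- Suppose θ(v̄) defines All_k' and let c be the number of dependency atoms in θ.
-- Work in the structure M = Fin (c + 1).  The full team U satisfies θ; fix a
-- witness of this.  In that witness every atom occurrence is evaluated on a
-- subteam of U, and shrinking U to a team W' shrinks each of these subteams
-- along the same path of team operations.  Two facts about shrinking:
--   * soundness: if every atom still sees all the tuples it saw, then W'
--     satisfies θ (all other constructs are downwards closed, atoms are upwards
--     closed);
--   * covering: if U is covered by W' ∪ W'', every tuple seen by an atom is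
--     still seen in the W'-version or in the W''-version.
-- For each k'-tuple a, the team "U without a" does not satisfy θ, so by
-- soundness it makes some atom lose some k-tuple: a label in Fin c × M^k.  By
-- covering, two different tuples a ≠ b cannot lose the same label.  But there
-- are c·(c+1)^k < (c+1)^k' labels, so the pigeonhole principle gives a clash.
-- Constructively the lost label exists only under double negation, which a
-- finite double-negation shift turns into the contradiction.

module Submission where

open import Defs
open import Data.Nat using (ℕ; _<_)
open import Relation.Nullary using (¬_)

open import Data.Nat using (zero; suc; _+_; _*_; _^_)
import Data.Nat.Properties as ℕ
open import Data.Fin using (Fin; zero; suc; combine; finToFun; funToFin)
import Data.Fin.Properties as Fin
open import Data.Vec.Functional using (Vector; []; _∷_; _++_; map; replicate)
open import Data.Vec.Functional.Relation.Unary.All using () renaming (All to Each)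
open import Data.Vec.Functional.Relation.Unary.All.Properties using (++⁺; ++⁻; replicate⁺)
open import Data.Product using (∃; ∃₂; ∃-syntax; _×_; _,_; proj₁; proj₂; uncurry)
open import Data.Product.Properties using (×-≡,≡→≡)
import Data.Sum as Sum
open import Data.Sum using (_⊎_; inj₁; inj₂; [_,_]′)
open import Data.Unit using (tt)
open import Function using (_∘_; id; Injective)
open import Function.Bundles using (_⇔_; mk⇔; Equivalence)
open import Relation.Binary.PropositionalEquality
  using (_≡_; _≢_; _≗_; refl; sym; trans; cong; cong₂; subst; module ≡-Reasoning)
open import Relation.Nullary using (yes; no; contradiction)
open import Relation.Unary using (_⊆_; _∩_; _∪_; ∅; U)
open import Level using (lift; lower)

¬¬-shift : ∀ {n} {P : Fin n → Set} → (∀ i → ¬ ¬ P i) → ¬ ¬ (∀ i → P i)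
¬¬-shift {zero}  h no-all = no-all λ ()
¬¬-shift {suc n} h no-all =
  h zero λ p₀ → ¬¬-shift (h ∘ suc) λ pₛ → no-all λ { zero → p₀ ; (suc i) → pₛ i }

¬∀⇒¬¬∃¬ : ∀ {m n} {P : Fin m × Fin n → Set} →
          ¬ (∀ i j → P (i , j)) → ¬ ¬ ∃ (¬_ ∘ P)
¬∀⇒¬¬∃¬ ¬all no-counterexample =
  ¬¬-shift (λ i → ¬¬-shift λ j ¬p → no-counterexample ((i , j) , ¬p)) ¬all

funToFin-cong : ∀ {m n} {f g : Fin m → Fin n} → f ≗ g → funToFin f ≡ funToFin g
funToFin-cong {zero}  f≗g = refl
funToFin-cong {suc m} f≗g = cong₂ combine (f≗g zero) (funToFin-cong (f≗g ∘ suc))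

finToFun-injective : ∀ {m n} {x y : Fin (n ^ m)} → finToFun {n} {m} x ≗ finToFun y → x ≡ y
finToFun-injective {m} {n} {x} {y} same = begin
  x                               ≡⟨ Fin.funToFin-finToFin {m} {n} x ⟨
  funToFin (finToFun {n} {m} x)   ≡⟨ funToFin-cong same ⟩
  funToFin (finToFun {n} {m} y)   ≡⟨ Fin.funToFin-finToFin {m} {n} y ⟩
  y                               ∎
  where open ≡-Reasoning

labels<tuples : ∀ c {k k'} → k < k' → c * suc c ^ k < suc c ^ k'
labels<tuples c {k} k<k' =
  ℕ.≤-trans (ℕ.+-monoˡ-≤ (c * suc c ^ k) (ℕ.m^n>0 (suc c) k)) (ℕ.^-monoʳ-≤ (suc c) k<k')

collision : ∀ {c k k'} → k < k' → (f : Fin (suc c ^ k') → Fin c × Fin (suc c ^ k)) →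
            ∃₂ λ x y → x ≢ y × f x ≡ f y
collision {c} k<k' f with Fin.pigeonhole (labels<tuples c k<k') (uncurry combine ∘ f)
... | x , y , x<y , same =
  x , y , Fin.<⇒≢ x<y , ×-≡,≡→≡ (Fin.combine-injective _ _ _ _ same)

realise : ∀ {M : Set} {m} → M → (vs : Fin m → ℕ) → Injective _≡_ _≡_ vs →
          (t : Fin m → M) → ∃[ s ] (∀ i → s (vs i) ≡ t i)
realise {M} default vs vs-injective t = s , s-realises
  where
  s : Assignment M
  s u with Fin.any? (λ i → vs i ℕ.≟ u)
  ... | yes (i , _) = t i
  ... | no _        = default

  s-realises : ∀ j → s (vs j) ≡ t j
  s-realises j with Fin.any? (λ i → vs i ℕ.≟ vs j)
  ... | yes (i , vsᵢ≡vsⱼ) = cong t (vs-injective vsᵢ≡vsⱼ)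
  ... | no none            = contradiction (j , refl) none

⟦⟧-resp : ∀ {M : Set} {m} {X : Team M} (vs : Fin m → ℕ) {t t' : Fin m → M} →
          t ≗ t' → (X ⟦ vs ⟧) t → (X ⟦ vs ⟧) t'
⟦⟧-resp vs t≗t' (s , s∈X , s≡t) = s , s∈X , λ i → trans (s≡t i) (t≗t' i)

supplement-mono : ∀ {M : Set} {W W' : Team M} {F} {v} →
                  W' ⊆ W → supplement W' F v ⊆ supplement W F v
supplement-mono W'⊆W (s , m , s∈W' , m∈F , t≐) = s , m , W'⊆W s∈W' , m∈F , t≐

supplement-∪ : ∀ {M : Set} {W W' W'' : Team M} {F} {v} → W ⊆ W' ∪ W'' →
               supplement W F v ⊆ supplement W' F v ∪ supplement W'' F v
supplement-∪ cover (s , m , s∈W , m∈F , t≐) =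
  Sum.map (λ s∈W' → s , m , s∈W' , m∈F , t≐) (λ s∈W'' → s , m , s∈W'' , m∈F , t≐)
          (cover s∈W)

duplicate-mono : ∀ {M : Set} {W W' : Team M} {v} →
                 W' ⊆ W → duplicate W' v ⊆ duplicate W v
duplicate-mono W'⊆W (s , m , s∈W' , t≐) = s , m , W'⊆W s∈W' , t≐

duplicate-∪ : ∀ {M : Set} {W W' W'' : Team M} {v} → W ⊆ W' ∪ W'' →
              duplicate W v ⊆ duplicate W' v ∪ duplicate W'' v
duplicate-∪ cover (s , m , s∈W , t≐) =
  Sum.map (λ s∈W' → s , m , s∈W' , t≐) (λ s∈W'' → s , m , s∈W'' , t≐) (cover s∈W)

atoms : ∀ {k} {𝒟 : DepNotion k → Set} → Formula 𝒟 → ℕ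
atoms (eq _ _)    = 0
atoms (neq _ _)   = 0
atoms (const _)   = 0
atoms (dep _ _ _) = 1
atoms (φ ∨ᶠ ψ)    = atoms φ + atoms ψ
atoms (φ ∧ᶠ ψ)    = atoms φ + atoms ψ
atoms (∃ᶠ _ φ)    = atoms φ
atoms (∀ᶠ _ φ)    = atoms φ
atoms (φ ⊔ᶠ ψ)    = atoms φ + atoms ψ

module Occurrences {k : ℕ} {𝒟 : DepNotion k → Set} {M : Set} where

  -- An atom occurrence in a witness of M ⊨_W φ: its variables, the subteam of W
  -- it is evaluated on, and the map sending a subteam W' of W to the
  -- corresponding subteam of W' (the same splits and quantifier steps).
  record Occurrence : Set₁ where
    constructor occurrence
    field
      vars     : Fin k → ℕ
      team     : Team M
      restrict : Team M → Team M
  open Occurrence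

  after : (Team M → Team M) → Occurrence → Occurrence
  after f o = record o { restrict = restrict o ∘ f }

  -- Atoms in the unused disjunct of ⊔ are evaluated on nothing.
  unused : Occurrence
  unused = occurrence (λ _ → 0) ∅ (λ _ → ∅)

  occurrences : (φ : Formula 𝒟) (W : Team M) → Sat M W φ → Vector Occurrence (atoms φ)
  occurrences (eq _ _)      W _ = []
  occurrences (neq _ _)     W _ = []
  occurrences (const _)     W _ = []
  occurrences (dep _ _ vs)  W _ = occurrence vs W id ∷ []
  occurrences (φ ∨ᶠ ψ) W (Y , Z , _ , dY , dZ) =
    map (after (_∩ Y)) (occurrences φ Y dY) ++ map (after (_∩ Z)) (occurrences ψ Z dZ)
  occurrences (φ ∧ᶠ ψ) W (dφ , dψ) = occurrences φ W dφ ++ occurrences ψ W dψ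
  occurrences (∃ᶠ v φ) W (F , _ , d) =
    map (after λ W' → supplement W' F v) (occurrences φ (supplement W F v) d)
  occurrences (∀ᶠ v φ) W d =
    map (after λ W' → duplicate W' v) (occurrences φ (duplicate W v) d)
  occurrences (φ ⊔ᶠ ψ) W (inj₁ d) = occurrences φ W d ++ replicate (atoms ψ) unused
  occurrences (φ ⊔ᶠ ψ) W (inj₂ d) = replicate (atoms φ) unused ++ occurrences ψ W d

  Keeps : Occurrence → Team M → (Fin k → M) → Set
  Keeps o W' t = (team o ⟦ vars o ⟧) t → (restrict o W' ⟦ vars o ⟧) t

  KeepsAll : Team M → Occurrence → Set
  KeepsAll W' o = ∀ t → Keeps o W' t

  keeps-resp : ∀ {o W'} {t t' : Fin k → M} → t ≗ t' → Keeps o W' t → Keeps o W' t'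
  keeps-resp {o} t≗t' keeps = ⟦⟧-resp (vars o) t≗t' ∘ keeps ∘ ⟦⟧-resp (vars o) (sym ∘ t≗t')

  restrict-sat : (∀ 𝐃 → 𝒟 𝐃 → UpwardsClosed 𝐃) →
                 (φ : Formula 𝒟) (W : Team M) (d : Sat M W φ) (W' : Team M) → W' ⊆ W →
                 Each (KeepsAll W') (occurrences φ W d) → Sat M W' φ
  restrict-sat up (eq _ _)  W d W' W'⊆W _ = lift λ s s∈W' → lower d s (W'⊆W s∈W')
  restrict-sat up (neq _ _) W d W' W'⊆W _ = lift λ s s∈W' → lower d s (W'⊆W s∈W')
  restrict-sat up (const _) W d W' W'⊆W _ =
    lift λ s s' s∈W' s'∈W' → lower d s s' (W'⊆W s∈W') (W'⊆W s'∈W')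
  restrict-sat up (dep 𝐃 𝐃∈𝒟 vs) W d W' _ keeps =
    lift (up 𝐃 𝐃∈𝒟 M _ _ (lower d) (keeps zero))
  restrict-sat up (φ ∨ᶠ ψ) W (Y , Z , W=Y∪Z , dY , dZ) W' W'⊆W keeps =
    W' ∩ Y , W' ∩ Z , split ,
    restrict-sat up φ Y dY (W' ∩ Y) proj₂ (proj₁ (++⁻ (KeepsAll W') _ keeps)) ,
    restrict-sat up ψ Z dZ (W' ∩ Z) proj₂ (proj₂ (++⁻ (KeepsAll W') _ keeps))
    where
    split : ∀ s → W' s ⇔ ((W' ∩ Y) s ⊎ (W' ∩ Z) s)
    split s = mk⇔ (λ s∈W' → Sum.map (s∈W' ,_) (s∈W' ,_)
                               (Equivalence.to (W=Y∪Z s) (W'⊆W s∈W')))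
                  [ proj₁ , proj₁ ]′
  restrict-sat up (φ ∧ᶠ ψ) W (dφ , dψ) W' W'⊆W keeps =
    restrict-sat up φ W dφ W' W'⊆W (proj₁ (++⁻ (KeepsAll W') _ keeps)) ,
    restrict-sat up ψ W dψ W' W'⊆W (proj₂ (++⁻ (KeepsAll W') _ keeps))
  restrict-sat up (∃ᶠ v φ) W (F , F-total , d) W' W'⊆W keeps =
    F , (λ s s∈W' → F-total s (W'⊆W s∈W')) ,
    restrict-sat up φ _ d _ (supplement-mono W'⊆W) keeps
  restrict-sat up (∀ᶠ v φ) W d W' W'⊆W keeps =
    restrict-sat up φ _ d _ (duplicate-mono W'⊆W) keeps
  restrict-sat up (φ ⊔ᶠ ψ) W (inj₁ d) W' W'⊆W keeps =
    inj₁ (restrict-sat up φ W d W' W'⊆W (proj₁ (++⁻ (KeepsAll W') _ keeps)))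
  restrict-sat up (φ ⊔ᶠ ψ) W (inj₂ d) W' W'⊆W keeps =
    inj₂ (restrict-sat up ψ W d W' W'⊆W (proj₂ (++⁻ (KeepsAll W') _ keeps)))

  Covers : Team M → Team M → Occurrence → Set
  Covers W' W'' o = team o ⊆ restrict o W' ∪ restrict o W''

  occurrences-cover : (φ : Formula 𝒟) (W : Team M) (d : Sat M W φ) {W' W'' : Team M} →
                      W ⊆ W' ∪ W'' → Each (Covers W' W'') (occurrences φ W d)
  occurrences-cover (eq _ _)     W d cover = λ ()
  occurrences-cover (neq _ _)    W d cover = λ ()
  occurrences-cover (const _)    W d cover = λ ()
  occurrences-cover (dep _ _ _)  W d cover = λ { zero → cover }
  occurrences-cover (φ ∨ᶠ ψ) W (Y , Z , W=Y∪Z , dY , dZ) {W'} {W''} cover =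
    ++⁺ (Covers W' W'') (occurrences-cover φ Y dY (within inj₁))
        (occurrences-cover ψ Z dZ (within inj₂))
    where
    within : ∀ {P : Team M} → P ⊆ Y ∪ Z → P ⊆ (W' ∩ P) ∪ (W'' ∩ P)
    within P⊆Y∪Z p = Sum.map (_, p) (_, p) (cover (Equivalence.from (W=Y∪Z _) (P⊆Y∪Z p)))
  occurrences-cover (φ ∧ᶠ ψ) W (dφ , dψ) {W'} {W''} cover =
    ++⁺ (Covers W' W'') (occurrences-cover φ W dφ cover) (occurrences-cover ψ W dψ cover)
  occurrences-cover (∃ᶠ v φ) W (F , _ , d) cover = occurrences-cover φ _ d (supplement-∪ cover)
  occurrences-cover (∀ᶠ v φ) W d cover = occurrences-cover φ _ d (duplicate-∪ cover)
  occurrences-cover (φ ⊔ᶠ ψ) W (inj₁ d) {W'} {W''} cover =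
    ++⁺ (Covers W' W'') (occurrences-cover φ W d cover)
        (replicate⁺ {P = Covers W' W''} {x = unused} λ ())
  occurrences-cover (φ ⊔ᶠ ψ) W (inj₂ d) {W'} {W''} cover =
    ++⁺ (Covers W' W'') (replicate⁺ {P = Covers W' W''} {x = unused} λ ())
        (occurrences-cover ψ W d cover)

  keeps-of-cover : ∀ o {W' W'' t} → Covers W' W'' o → ¬ Keeps o W'' t → Keeps o W' t
  keeps-of-cover o cover lost (s , s∈team , s≡t) with cover s∈team
  ... | inj₁ s∈W'  = s , s∈W' , s≡t
  ... | inj₂ s∈W'' = contradiction (λ _ → s , s∈W'' , s≡t) lost

module TotalityNotDefinable
  {k k' : ℕ} (k<k' : k < k') {𝒟 : DepNotion k → Set}
  (upClosed : ∀ 𝐃 → 𝒟 𝐃 → UpwardsClosed 𝐃)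
  (vs : Fin k' → ℕ) (vs-injective : Injective _≡_ _≡_ vs) (θ : Formula 𝒟)
  (defines : ∀ (M : Set) → M → ∀ (X : Team M) →
               (All k' M (X ⟦ vs ⟧) → Sat M X θ) × (Sat M X θ → All k' M (X ⟦ vs ⟧)))
  where

  c : ℕ
  c = atoms θ

  M : Set
  M = Fin (suc c)

  open Occurrences {k} {𝒟} {M}

  full-sat : Sat M U θ
  full-sat = proj₁ (defines M zero U) λ t →
    let (s , s-realises) = realise zero vs vs-injective t in s , tt , s-realises

  occ : Vector Occurrence c
  occ = occurrences θ U full-sat

  without : (Fin k' → M) → Team M
  without a s = ¬ (∀ i → s (vs i) ≡ a i)

  without-fails : ∀ a → ¬ Sat M (without a) θ
  without-fails a sat with proj₂ (defines M zero (without a)) sat a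
  ... | s , s∉ , s≡a = s∉ s≡a

  Label : Set
  Label = Fin c × Fin (suc c ^ k)

  Loses : (Fin k' → M) → Label → Set
  Loses a (i , e) = ¬ Keeps (occ i) (without a) (finToFun e)

  -- By soundness of shrinking, removing a tuple loses some label.
  loses-something : ∀ a → ¬ ¬ ∃ (Loses a)
  loses-something a = ¬∀⇒¬¬∃¬ λ keeps →
    without-fails a (restrict-sat upClosed θ U full-sat (without a) (λ _ → tt)
      λ i t → keeps-resp {occ i} (Fin.finToFun-funToFin t) (keeps i (funToFin t)))

  without-cover : ∀ {a b} → ¬ (a ≗ b) → U ⊆ without a ∪ without b
  without-cover {a} {b} a≉b {s} _ with Fin.all? (λ i → s (vs i) Fin.≟ a i)
  ... | yes s≡a = inj₂ λ s≡b → a≉b λ i → trans (sym (s≡a i)) (s≡b i)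
  ... | no  s≢a = inj₁ s≢a

  distinct-losses : ∀ {a b} ℓ → ¬ (a ≗ b) → Loses a ℓ → ¬ Loses b ℓ
  distinct-losses {a} {b} (i , e) a≉b lost-a lost-b =
    lost-a (keeps-of-cover (occ i) (covers i) lost-b)
    where
    covers : Each (Covers (without a) (without b)) occ
    covers = occurrences-cover θ U full-sat (λ {s} → without-cover a≉b {s})

  no-labelling : ¬ (∀ x → ∃ (Loses (finToFun x)))
  no-labelling lose with collision k<k' (proj₁ ∘ lose)
  ... | x , y , x≢y , same =
    distinct-losses (proj₁ (lose x)) (x≢y ∘ finToFun-injective)
      (proj₂ (lose x)) (subst (Loses (finToFun y)) (sym same) (proj₂ (lose y)))

mainTheorem3 : (k k' : ℕ) → k < k' → (𝒟 : DepNotion k → Set) →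
               (∀ 𝐃 → 𝒟 𝐃 → UpwardsClosed 𝐃) →
               ¬ Definable 𝒟 (All k')
mainTheorem3 k k' k<k' 𝒟 upClosed (vs , vs-injective , θ , _ , defines) =
  ¬¬-shift (loses-something ∘ finToFun) no-labelling
  where open TotalityNotDefinable k<k' upClosed vs vs-injective θ defines
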